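{- For every positive integer $N$, the set $\{n^2: n\in\mathbb{Z},\ N\leq n\leq N+2\sqrt2N^{1/2}\}$ is a Sidon set.
   Context: A set $A\subseteq\mathbb{Z}$ is a Sidon set if the only solutions of $a_1+b_1=a_2+b_2$ with $a_1,b_1,a_2,b_2\in A$ are the trivial ones, i.e. those with $\{a_1,b_1\}=\{a_2,b_2\}$. -}

module Defs where

open import Data.Integer using (ℤ; +_; _+_; _-_; _*_; _≤_)
open import Data.Product using (Σ; _×_)
open import Data.Sum using (_⊎_)
open import Relation.Binary.PropositionalEquality using (_≡_)

IsSidon : (ℤ → Set) → Set
IsSidon A = ∀ a₁ b₁ a₂ b₂ → A a₁ → A b₁ → A a₂ → A b₂ →
  a₁ + b₁ ≡ a₂ + b₂ → (a₁ ≡ a₂ × b₁ ≡ b₂) ⊎ (a₁ ≡ b₂ × b₁ ≡ a₂)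

-- The real condition  n ≤ N + 2√2 · N^{1/2}  for an integer n with N ≤ n
-- is equivalent (as n - N ≥ 0) to  (n - N)² ≤ 8N, written without reals.
InRange : ℤ → ℤ → Set
InRange N n = (N ≤ n) × ((n - N) * (n - N) ≤ + 8 * N)

SquaresSet : ℤ → ℤ → Set
SquaresSet N x = Σ ℤ (λ n → InRange N n × x ≡ n * n)

{-# OPTIONS --safe #-}

-- Write the elements as (N + x)² with 0 ≤ x ≤ √(8N). If
-- (N + x)² + (N + y)² = (N + z)² + (N + w)² with x + y = z + w + k and k > 0, then
-- 2Nk + x² + y² = z² + w²; reducing mod 2 shows k is even, so k ≥ 2. By the
-- parallelogram law 2(m² + n²) = (m + n)² + |m − n|², the left side doubled is at
-- least 8N + (z + w + k)², whereas 2(z² + w²) ≤ (z + w)² + max(z, w)² ≤ (z + w)² + 8N.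
-- Hence x + y = z + w, and then x² + y² = z² + w² forces {x, y} = {z, w}.
module Submission where

open import Defs
open import Data.Nat using (ℕ; _<_)
open import Data.Integer using (+_)

open import Data.Nat
  using (zero; suc; _+_; _*_; _≤_; _⊔_; ∣_-_∣; z≤n; s≤s)
open import Data.Nat.Properties
open import Data.Nat.Divisibility using (_∣_; ∣⇒≤; ∣m∣n⇒∣m+n; ∣m+n∣m⇒∣n; m∣m*n; ∣m⇒∣m*n)
open import Data.Nat.Tactic.RingSolver using (solve-∀)
import Data.Integer as ℤ
open import Data.Integer.Base using (+≤+)
open import Data.Integer.Properties
  using (drop‿+≤+; [+m]-[+n]≡m⊖n; ⊖-≥; pos-*; pos-+; +-injective)
open import Data.Product using (∃-syntax; _×_; _,_)
open import Data.Sum using (_⊎_; inj₁; inj₂)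
open import Data.Empty using (⊥; ⊥-elim)
open import Relation.Binary.PropositionalEquality
open import Relation.Binary.Definitions using (tri<; tri≈; tri>)

parallelogram-≤ : ∀ {m n} → m ≤ n →
  2 * (m * m + n * n) ≡ (m + n) * (m + n) + ∣ m - n ∣ * ∣ m - n ∣
parallelogram-≤ {m} m≤n with m≤n⇒∃[o]m+o≡n m≤n
... | d , refl rewrite ∣m-m+n∣≡n m d = identity m d
  where
  identity : ∀ m d → 2 * (m * m + (m + d) * (m + d)) ≡ (m + (m + d)) * (m + (m + d)) + d * d
  identity = solve-∀

parallelogram : ∀ m n → 2 * (m * m + n * n) ≡ (m + n) * (m + n) + ∣ m - n ∣ * ∣ m - n ∣
parallelogram m n with ≤-total m n
... | inj₁ m≤n = parallelogram-≤ m≤n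
... | inj₂ n≤m = begin
  2 * (m * m + n * n)                       ≡⟨ cong (2 *_) (+-comm (m * m) (n * n)) ⟩
  2 * (n * n + m * m)                       ≡⟨ parallelogram-≤ n≤m ⟩
  (n + m) * (n + m) + ∣ n - m ∣ * ∣ n - m ∣  ≡⟨ cong₂ (λ s d → s * s + d * d) (+-comm n m) (∣-∣-comm n m) ⟩
  (m + n) * (m + n) + ∣ m - n ∣ * ∣ m - n ∣  ∎
  where open ≡-Reasoning

square-of-sum≤double-sum-of-squares : ∀ m n → (m + n) * (m + n) ≤ 2 * (m * m + n * n)
square-of-sum≤double-sum-of-squares m n =
  subst ((m + n) * (m + n) ≤_) (sym (parallelogram m n)) (m≤m+n _ _)

square-⊔-≤ : ∀ {b} m n → m * m ≤ b → n * n ≤ b → (m ⊔ n) * (m ⊔ n) ≤ b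
square-⊔-≤ m n m²≤b n²≤b with ⊔-sel m n
... | inj₁ m⊔n≡m rewrite m⊔n≡m = m²≤b
... | inj₂ m⊔n≡n rewrite m⊔n≡n = n²≤b

double-sum-of-squares-≤ : ∀ {b} m n → m * m ≤ b → n * n ≤ b →
  2 * (m * m + n * n) ≤ (m + n) * (m + n) + b
double-sum-of-squares-≤ {b} m n m²≤b n²≤b =
  subst (_≤ (m + n) * (m + n) + b) (sym (parallelogram m n))
    (+-monoʳ-≤ ((m + n) * (m + n))
      (≤-trans (*-mono-≤ (∣m-n∣≤m⊔n m n) (∣m-n∣≤m⊔n m n)) (square-⊔-≤ m n m²≤b n²≤b)))

sum-of-squares-injective-≤ : ∀ {x y z w} → x ≤ z → x + y ≡ z + w →
  x * x + y * y ≡ z * z + w * w → (x ≡ z × y ≡ w) ⊎ (x ≡ w × y ≡ z)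
sum-of-squares-injective-≤ {x} {y} {w = w} x≤z S E with m≤n⇒∃[o]m+o≡n x≤z
... | o , refl with +-cancelˡ-≡ x y (o + w) (trans S (+-assoc x o w))
... | refl with o
...   | zero = inj₁ (sym (+-identityʳ x) , refl)
...   | suc p = inj₂ (sym w≡x , trans (cong (_+_ (suc p)) w≡x) (+-comm (suc p) x))
  where
  expandˡ : ∀ x o w → x * x + (o + w) * (o + w) ≡ (x * x + o * o + w * w) + 2 * o * w
  expandˡ = solve-∀
  expandʳ : ∀ x o w → (x + o) * (x + o) + w * w ≡ (x * x + o * o + w * w) + 2 * o * x
  expandʳ = solve-∀
  w≡x : w ≡ x
  w≡x = *-cancelˡ-≡ w x (2 * suc p)
    (+-cancelˡ-≡ (x * x + suc p * suc p + w * w) _ _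
      (trans (sym (expandˡ x (suc p) w)) (trans E (expandʳ x (suc p) w))))

sum-of-squares-injective : ∀ x y z w → x + y ≡ z + w →
  x * x + y * y ≡ z * z + w * w → (x ≡ z × y ≡ w) ⊎ (x ≡ w × y ≡ z)
sum-of-squares-injective x y z w S E with ≤-total x z
... | inj₁ x≤z = sum-of-squares-injective-≤ x≤z S E
... | inj₂ z≤x with sum-of-squares-injective-≤ z≤x (sym S) (sym E)
...   | inj₁ (z≡x , w≡y) = inj₁ (sym z≡x , sym w≡y)
...   | inj₂ (z≡y , w≡x) = inj₂ (sym w≡x , sym z≡y)

2∣n*n+n : ∀ n → 2 ∣ n * n + n
2∣n*n+n zero = m∣m*n 0
2∣n*n+n (suc n) = subst (2 ∣_) (sym (step n)) (∣m∣n⇒∣m+n (2∣n*n+n n) (m∣m*n (suc n)))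
  where
  step : ∀ n → suc n * suc n + suc n ≡ (n * n + n) + 2 * suc n
  step = solve-∀

shifted-squares-expansion : ∀ N x y →
  (N + x) * (N + x) + (N + y) * (N + y) ≡ (2 * N * N + 2 * N * (x + y)) + (x * x + y * y)
shifted-squares-expansion = solve-∀

shifted-squares-difference : ∀ N x y z w k → x + y ≡ (z + w) + k →
  (N + x) * (N + x) + (N + y) * (N + y) ≡ (N + z) * (N + z) + (N + w) * (N + w) →
  2 * N * k + (x * x + y * y) ≡ z * z + w * w
shifted-squares-difference N x y z w k S E =
  +-cancelˡ-≡ (2 * N * N + 2 * N * (z + w)) _ _ (begin
    (2 * N * N + 2 * N * (z + w)) + (2 * N * k + (x * x + y * y))
      ≡⟨ regroup N (z + w) k (x * x + y * y) ⟩
    (2 * N * N + 2 * N * ((z + w) + k)) + (x * x + y * y)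
      ≡⟨ cong (λ s → (2 * N * N + 2 * N * s) + (x * x + y * y)) (sym S) ⟩
    (2 * N * N + 2 * N * (x + y)) + (x * x + y * y)
      ≡⟨ sym (shifted-squares-expansion N x y) ⟩
    (N + x) * (N + x) + (N + y) * (N + y)
      ≡⟨ E ⟩
    (N + z) * (N + z) + (N + w) * (N + w)
      ≡⟨ shifted-squares-expansion N z w ⟩
    (2 * N * N + 2 * N * (z + w)) + (z * z + w * w) ∎)
  where
  open ≡-Reasoning
  regroup : ∀ N t k g → (2 * N * N + 2 * N * t) + (2 * N * k + g) ≡ (2 * N * N + 2 * N * (t + k)) + g
  regroup = solve-∀

-- m² ≡ m (mod 2) turns the equation into k ≡ 2Nk (mod 2).
excess-even : ∀ N x y z w k → x + y ≡ (z + w) + k →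
  2 * N * k + (x * x + y * y) ≡ z * z + w * w → 2 ∣ k
excess-even N x y z w k S H = ∣m+n∣m⇒∣n (subst (2 ∣_) (sym balance) 2∣rhs)
  (∣m∣n⇒∣m+n (2∣n*n+n z) (2∣n*n+n w))
  where
  open ≡-Reasoning
  2∣rhs : 2 ∣ 2 * N * k + ((x * x + x) + (y * y + y))
  2∣rhs = ∣m∣n⇒∣m+n (∣m⇒∣m*n k (m∣m*n N)) (∣m∣n⇒∣m+n (2∣n*n+n x) (2∣n*n+n y))
  regroupˡ : ∀ z w k → ((z * z + z) + (w * w + w)) + k ≡ (z * z + w * w) + ((z + w) + k)
  regroupˡ = solve-∀
  regroupʳ : ∀ N k x y → (2 * N * k + (x * x + y * y)) + (x + y) ≡ 2 * N * k + ((x * x + x) + (y * y + y))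
  regroupʳ = solve-∀
  balance : ((z * z + z) + (w * w + w)) + k ≡ 2 * N * k + ((x * x + x) + (y * y + y))
  balance = begin
    ((z * z + z) + (w * w + w)) + k       ≡⟨ regroupˡ z w k ⟩
    (z * z + w * w) + ((z + w) + k)       ≡⟨ cong₂ _+_ (sym H) (sym S) ⟩
    (2 * N * k + (x * x + y * y)) + (x + y) ≡⟨ regroupʳ N k x y ⟩
    2 * N * k + ((x * x + x) + (y * y + y)) ∎

large-excess-impossible : ∀ N x y z w k → 2 ≤ k → z * z ≤ 8 * N → w * w ≤ 8 * N →
  x + y ≡ (z + w) + k → 2 * N * k + (x * x + y * y) ≡ z * z + w * w → ⊥
large-excess-impossible N x y z w k 2≤k z²≤8N w²≤8N S H = <-irrefl refl (begin-strict
  t * t + 8 * N               <⟨ +-mono-<-≤ (*-mono-< t<t+k t<t+k) 8N≤4Nk ⟩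
  (t + k) * (t + k) + 4 * N * k ≡⟨ cong (λ s → s * s + 4 * N * k) (sym S) ⟩
  (x + y) * (x + y) + 4 * N * k ≤⟨ +-monoˡ-≤ (4 * N * k) (square-of-sum≤double-sum-of-squares x y) ⟩
  2 * (x * x + y * y) + 4 * N * k ≡⟨ double N k (x * x + y * y) ⟩
  2 * (2 * N * k + (x * x + y * y)) ≡⟨ cong (2 *_) H ⟩
  2 * (z * z + w * w)          ≤⟨ double-sum-of-squares-≤ z w z²≤8N w²≤8N ⟩
  t * t + 8 * N               ∎)
  where
  open ≤-Reasoning
  t : ℕ
  t = z + w
  t<t+k : t < t + k
  t<t+k = m<m+n t (≤-trans (s≤s z≤n) 2≤k)
  eight : ∀ N → 4 * N * 2 ≡ 8 * N
  eight = solve-∀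
  8N≤4Nk : 8 * N ≤ 4 * N * k
  8N≤4Nk = subst (_≤ 4 * N * k) (eight N) (*-monoʳ-≤ (4 * N) 2≤k)
  double : ∀ N k g → 2 * g + 4 * N * k ≡ 2 * (2 * N * k + g)
  double = solve-∀

excess-impossible : ∀ N x y z w → z * z ≤ 8 * N → w * w ≤ 8 * N → z + w < x + y →
  (N + x) * (N + x) + (N + y) * (N + y) ≡ (N + z) * (N + z) + (N + w) * (N + w) → ⊥
excess-impossible N x y z w z²≤8N w²≤8N z+w<x+y E with m≤n⇒∃[o]m+o≡n z+w<x+y
... | o , p = large-excess-impossible N x y z w (suc o)
                (∣⇒≤ (excess-even N x y z w (suc o) S H)) z²≤8N w²≤8N S H
  where
  S : x + y ≡ (z + w) + suc o
  S = trans (sym p) (sym (+-suc (z + w) o))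
  H : 2 * N * suc o + (x * x + y * y) ≡ z * z + w * w
  H = shifted-squares-difference N x y z w (suc o) S E

shifted-squares-sidon : ∀ N x y z w →
  x * x ≤ 8 * N → y * y ≤ 8 * N → z * z ≤ 8 * N → w * w ≤ 8 * N →
  (N + x) * (N + x) + (N + y) * (N + y) ≡ (N + z) * (N + z) + (N + w) * (N + w) →
  (x ≡ z × y ≡ w) ⊎ (x ≡ w × y ≡ z)
shifted-squares-sidon N x y z w x²≤8N y²≤8N z²≤8N w²≤8N E with <-cmp (x + y) (z + w)
... | tri< x+y<z+w _ _ = ⊥-elim (excess-impossible N z w x y x²≤8N y²≤8N x+y<z+w (sym E))
... | tri> _ _ z+w<x+y = ⊥-elim (excess-impossible N x y z w z²≤8N w²≤8N z+w<x+y E)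
... | tri≈ _ S _ = sum-of-squares-injective x y z w S
        (trans (sym (cong (_+ (x * x + y * y)) (*-zeroʳ (2 * N))))
          (shifted-squares-difference N x y z w 0 (trans S (sym (+-identityʳ (z + w)))) E))

InRange⇒offset : ∀ N n → InRange (+ N) n → ∃[ x ] n ≡ + (N + x) × x * x ≤ 8 * N
InRange⇒offset N (+ m) (+≤+ N≤m , bound) with m≤n⇒∃[o]m+o≡n N≤m
... | x , refl = x , refl , drop‿+≤+ (subst₂ ℤ._≤_ square (sym (pos-* 8 N)) bound)
  where
  offset : + (N + x) ℤ.- + N ≡ + x
  offset = trans ([+m]-[+n]≡m⊖n (N + x) N) (trans (⊖-≥ (m≤m+n N x)) (cong +_ (m+n∸m≡n N x)))
  square : (+ (N + x) ℤ.- + N) ℤ.* (+ (N + x) ℤ.- + N) ≡ + (x * x)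
  square = trans (cong₂ ℤ._*_ offset offset) (sym (pos-* x x))

shifted-square : ℕ → ℕ → ℕ
shifted-square N x = (N + x) * (N + x)

SquaresSet⇒shifted-square : ∀ N a → SquaresSet (+ N) a →
  ∃[ x ] a ≡ + shifted-square N x × x * x ≤ 8 * N
SquaresSet⇒shifted-square N a (n , n∈range , a≡n²) with InRange⇒offset N n n∈range
... | x , refl , x²≤8N = x , trans a≡n² (sym (pos-* (N + x) (N + x))) , x²≤8N

proposition5p1 : (N : ℕ) → 0 < N → IsSidon (SquaresSet (+ N))
proposition5p1 N _ a₁ b₁ a₂ b₂ a₁∈ b₁∈ a₂∈ b₂∈ eq
  with SquaresSet⇒shifted-square N a₁ a₁∈ | SquaresSet⇒shifted-square N b₁ b₁∈
     | SquaresSet⇒shifted-square N a₂ a₂∈ | SquaresSet⇒shifted-square N b₂ b₂∈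
... | x , refl , x²≤8N | y , refl , y²≤8N | z , refl , z²≤8N | w , refl , w²≤8N
  with shifted-squares-sidon N x y z w x²≤8N y²≤8N z²≤8N w²≤8N
         (+-injective (trans (sym (pos-+ (shifted-square N x) (shifted-square N y))) (trans eq (pos-+ (shifted-square N z) (shifted-square N w)))))
... | inj₁ (x≡z , y≡w) = inj₁ (cong (λ t → + shifted-square N t) x≡z , cong (λ t → + shifted-square N t) y≡w)
... | inj₂ (x≡w , y≡z) = inj₂ (cong (λ t → + shifted-square N t) x≡w , cong (λ t → + shifted-square N t) y≡z)
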